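{- Let $q\ge2$ and $n\ge1$ be integers, let $g\in\mathcal{F}_q\setminus\{\mathit{1}_q\}$, and let $\Phi=\mathcal{F}_q\setminus\{g\}$. Under scenario $(\bullet *)$, $\Phi$ is $n$-cell implementable if and only if $q\le n+1$.
   Context: $[b\rangle=\{0,1,\ldots,b-1\}$. Let $\mathbb{B}=\{0,1\}$, $\mathbb{B}_\circ=\mathbb{B}$, $\mathbb{B}_*=\mathbb{B}\cup\{*\}$, $\mathbb{B}_\bullet=\mathbb{B}\cup\{*,\bullet\}$. Define $\mathrm{T}:\mathbb{B}_\bullet^2\to\mathbb{B}$ by $\mathrm{T}(u,\vartheta)=1$ if and only if $u=*$, or $\vartheta=*$, or $u=\vartheta\in\mathbb{B}$. $\mathcal{F}_q$ is the set of all functions $[q\rangle\to\mathbb{B}$; $\mathit{1}_q\in\mathcal{F}_q$ is the constant-$1$ function. For $\alpha,\beta\in\{\circ,*,\bullet\}$, a subset $\Phi\subseteq\mathcal{F}_q$ is $n$-cell implementable under scenario $(\alpha\beta)$ if there exist mappings $\mathbf{u}=(u_j)_{j\in[n\rangle}:[q\rangle\to\mathbb{B}_\alpha^n$ and $\boldsymbol{\vartheta}=(\vartheta_j)_{j\in[n\rangle}:\Phi\to\mathbb{B}_\beta^n$ such that $f(x)=\bigwedge_{j\in[n\rangle}\mathrm{T}(u_j(x),\vartheta_j(f))$ for all $f\in\Phi$ and $x\in[q\rangle$. -}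

module Defs where

open import Data.Bool using (Bool; true; false; _∧_)
open import Data.Bool.Properties using (_≟_)
open import Data.Nat using (ℕ)
open import Data.Fin using (Fin)
open import Data.Product using (Σ; _×_; _,_)
open import Relation.Nullary using (¬_; yes; no)
open import Relation.Binary.PropositionalEquality using (_≡_; _≗_)

data B• : Set where
  bit    : Bool → B•
  star   : B•
  bullet : B•

data B* : Set where
  bit  : Bool → B*
  star : B*

embed* : B* → B•
embed* (bit b) = bit b
embed* star    = star

T : B• → B• → Bool
T star     _          = true
T (bit _)  star       = true
T bullet   star       = true
T (bit a)  (bit b)    with a ≟ b
... | yes _ = true
... | no  _ = false
T (bit _)  bullet     = false
T bullet   (bit _)    = false
T bullet   bullet     = false

⋀ : (n : ℕ) → (Fin n → Bool) → Bool
⋀ ℕ.zero    h = true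
⋀ (ℕ.suc n) h = h Fin.zero ∧ ⋀ n (λ j → h (Fin.suc j))

ℱ : ℕ → Set
ℱ q = Fin q → Bool

𝟙 : (q : ℕ) → ℱ q
𝟙 q _ = true

Φ∖ : (q : ℕ) → ℱ q → Set
Φ∖ q g = Σ (ℱ q) (λ f → ¬ (f ≗ g))

Implementable•* : (q n : ℕ) → ℱ q → Set
Implementable•* q n g =
  Σ (Fin q → Fin n → B•) λ u →
  Σ (Φ∖ q g → Fin n → B*) λ ϑ →
  (φ : Φ∖ q g) → (x : Fin q) →
    Φf φ x ≡ ⋀ n (λ j → T (u x j) (embed* (ϑ φ j)))
  where
  Φf : Φ∖ q g → ℱ q
  Φf (f , _) = f

-- Fix a point z with g z = 0 and look at the other q - 1 points. For every set S of them,
-- the function that is 1 at z and 0 exactly on S lies in Φ, so the cells must be able to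
-- switch off exactly S; a cell whose state is the bit b switches off the points x with
-- u x ∉ {*, b}. Such a "kill system" on m points with n cells can realise every subset
-- only if m ≤ n: singletons force every point to be isolated by some cell, and when two
-- points share their isolating cell, deleting that cell and identifying the two points
-- gives a smaller kill system that still realises every subset.
-- Conversely, q - 1 cells suffice: the cell of a point w fixes f w directly and, when
-- f z = 0, it also switches off z as soon as f w ≠ g w, which happens for some w as f ≠ g.
module Submission where

open import Defs
open import Data.Nat using (ℕ; _≤_; _+_)
open import Relation.Nullary using (¬_)
open import Relation.Binary.PropositionalEquality using (_≗_)
open import Function.Bundles using (_⇔_)

open import Level using (0ℓ)
open import Data.Nat using (zero; suc; s≤s; z≤n; _≤′_; ≤′-refl; ≤′-step)
open import Data.Nat.Properties using (_≤?_; ≰⇒>; ≤⇒≤′; ≤-pred; +-comm)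
open import Data.Fin using (Fin; zero; suc; punchIn; punchOut; _≟_)
open import Data.Fin.Properties
  using (suc-injective; <⇒≢; punchIn-punchOut; punchInᵢ≢i; punchIn-injective; ¬∀⟶∃¬; pigeonhole)
open import Data.Vec.Functional using (insertAt; _∷_)
open import Data.Vec.Functional.Properties using (insertAt-lookup; insertAt-punchIn)
open import Data.Bool using (Bool; true; false; not; _∧_)
open import Data.Bool.Properties using (∧-identityʳ; ¬-not; not-injective)
  renaming (_≟_ to _≟ᵇ_)
open import Data.Maybe using (Maybe; just; nothing)
open import Data.Maybe.Properties using (just-injective)
open import Data.Product using (∃-syntax; _×_; _,_; proj₁; proj₂; map; map₂)
open import Data.Sum using (_⊎_; inj₁; inj₂)
open import Function using (id; _∘_; Equivalence; mk⇔)
open import Function.Properties.Equivalence using (⇔-setoid)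
open import Relation.Nullary using (yes; no; contradiction)
open import Relation.Nullary.Decidable using (does; proof; dec-true)
open import Relation.Nullary.Reflects using (Reflects; invert)
open import Relation.Unary using (Pred; _∈_; _⊆_; ｛_｝)
open import Relation.Binary.PropositionalEquality
  using (_≡_; _≢_; refl; sym; trans; cong; cong-app; subst; module ≡-Reasoning)
import Relation.Binary.Reasoning.Setoid as SetoidReasoning

open Equivalence using (to; from)

private
  variable
    n m q : ℕ

¬≗⇒∃≢ : {f g : Fin n → Bool} → ¬ f ≗ g → ∃[ x ] f x ≢ g x
¬≗⇒∃≢ {n} {f} {g} f≢g = ¬∀⟶∃¬ n (λ x → f x ≡ g x) (λ x → f x ≟ᵇ g x) f≢g

pivot-or-punchIn : (z x : Fin (suc n)) → z ≡ x ⊎ ∃[ i ] punchIn z i ≡ x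
pivot-or-punchIn z x with z ≟ x
... | yes z≡x = inj₁ z≡x
... | no  z≢x = inj₂ (punchOut z≢x , punchIn-punchOut z≢x)

⋀≡true : ∀ n {h : Fin n → Bool} → (∀ j → h j ≡ true) → ⋀ n h ≡ true
⋀≡true zero    _      = refl
⋀≡true (suc n) h≡true rewrite h≡true zero = ⋀≡true n (h≡true ∘ suc)

⋀≡false⇔∃ : ∀ n {h : Fin n → Bool} → ⋀ n h ≡ false ⇔ (∃[ j ] h j ≡ false)
⋀≡false⇔∃ n = mk⇔ (witness n) (λ (j , hj≡false) → refute n j hj≡false)
  where
  witness : ∀ n {h : Fin n → Bool} → ⋀ n h ≡ false → ∃[ j ] h j ≡ false
  witness (suc n) {h} ⋀≡false with h zero in h0
  ... | false = zero , h0
  ... | true  = map suc id (witness n ⋀≡false)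

  refute : ∀ n {h : Fin n → Bool} j → h j ≡ false → ⋀ n h ≡ false
  refute (suc n) {h} zero    h0≡false rewrite h0≡false = refl
  refute (suc n) {h} (suc j) hj≡false with h zero
  ... | true  = refute n j hj≡false
  ... | false = refl

⋀-single : ∀ n {h : Fin n → Bool} k → (∀ j → j ≢ k → h j ≡ true) → ⋀ n h ≡ h k
⋀-single (suc n) {h} zero others =
  trans (cong (h zero ∧_) (⋀≡true n (λ j → others (suc j) λ ()))) (∧-identityʳ (h zero))
⋀-single (suc n) (suc k) others rewrite others zero (λ ()) =
  ⋀-single n k (λ j j≢k → others (suc j) (j≢k ∘ suc-injective))

T-star : ∀ w → T w star ≡ true
T-star (bit _) = refl
T-star star    = refl
T-star bullet  = refl

toMaybe : B* → Maybe Bool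
toMaybe (bit b) = just b
toMaybe star    = nothing

T≡false⇔ : ∀ w t → T w (embed* t) ≡ false ⇔ (∃[ b ] toMaybe t ≡ just b × T w (bit b) ≡ false)
T≡false⇔ w (bit b) = mk⇔ (λ T≡false → b , refl , T≡false) λ { (_ , refl , T≡false) → T≡false }
T≡false⇔ w star    = mk⇔ (λ T≡false → contradiction (trans (sym (T-star w)) T≡false) λ ()) λ ()

KillSystem : ℕ → ℕ → Set₁
KillSystem n m = Fin n → Bool → Pred (Fin m) 0ℓ

Setting : ℕ → Set
Setting n = Fin n → Maybe Bool

Killed : KillSystem n m → Setting n → Pred (Fin m) 0ℓ
Killed K c x = ∃[ j ] ∃[ b ] c j ≡ just b × x ∈ K j b

Shatters : KillSystem n m → Set
Shatters K = (S : Fin _ → Bool) → ∃[ c ] ∀ x → S x ≡ true ⇔ Killed K c x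

Isolates : KillSystem n m → Fin n → Bool → Fin m → Set
Isolates K j b x = x ∈ K j b × K j b ⊆ ｛ x ｝

shatters⇒isolates : {K : KillSystem n m} → Shatters K → ∀ x → ∃[ j ] ∃[ b ] Isolates K j b x
shatters⇒isolates shatters x with shatters (λ z → does (x ≟ z))
... | c , realises with to (realises x) (dec-true (x ≟ x) refl)
... | j , b , cj , x∈ =
  j , b , x∈ , λ {z} z∈ →
    invert (subst (Reflects _) (from (realises z) (j , b , cj , z∈)) (proof (x ≟ z)))

isolating-pair⇒⊆ : {K : KillSystem n m} {j : Fin n} {b₁ b₂ : Bool} {x y : Fin m} →
  Isolates K j b₁ x → Isolates K j b₂ y → x ≢ y → ∀ b → K j b ⊆ ｛ x ｝ ⊎ K j b ⊆ ｛ y ｝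
isolating-pair⇒⊆ {K = K} {j} {b₁} {b₂} {x} (x∈ , ⊆x) (_ , ⊆y) x≢y b with b ≟ᵇ b₁ | b ≟ᵇ b₂
... | yes refl | _        = inj₁ ⊆x
... | no  _    | yes refl = inj₂ ⊆y
... | no b≢b₁  | no b≢b₂  = contradiction (sym (⊆y (subst (λ b′ → x ∈ K j b′) b₁≡b₂ x∈))) x≢y
  where
  b₁≡b₂ : b₁ ≡ b₂
  b₁≡b₂ = not-injective (trans (sym (¬-not b≢b₁)) (¬-not b≢b₂))

killed-split : {K : KillSystem (suc n) m} {c : Setting (suc n)} {x : Fin m} (j : Fin (suc n)) →
  Killed K c x → (∃[ b ] c j ≡ just b × x ∈ K j b) ⊎ Killed (K ∘ punchIn j) (c ∘ punchIn j) x
killed-split j (k , b , ck , x∈) with j ≟ k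
... | yes refl = inj₁ (b , ck , x∈)
... | no  j≢k rewrite sym (punchIn-punchOut j≢k) = inj₂ (punchOut j≢k , b , ck , x∈)

identify : Fin (suc m) → Fin m → Fin (suc m) → Fin m
identify a y = insertAt id a y

contract : KillSystem (suc n) (suc m) → Fin (suc n) → Fin (suc m) → Fin m → KillSystem n m
contract K j a y j′ b x = ∃[ z ] identify a y z ≡ x × z ∈ K (punchIn j j′) b

contract-shatters : {K : KillSystem (suc n) (suc m)} (j : Fin (suc n)) (a : Fin (suc m)) (y : Fin m) →
  (∀ b → K j b ⊆ ｛ a ｝ ⊎ K j b ⊆ ｛ punchIn a y ｝) →
  Shatters K → Shatters (contract K j a y)
contract-shatters {K = K} j a y cell-j shatters S with shatters (S ∘ identify a y)
... | c , realises = c ∘ punchIn j , λ x → mk⇔ (killed x) realised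
  where
  K′ = contract K j a y
  c′ = c ∘ punchIn j

  lift : ∀ {z} → Killed (K ∘ punchIn j) c′ z → Killed K′ c′ (identify a y z)
  lift (j′ , b , cj′ , z∈) = j′ , b , cj′ , _ , refl , z∈

  realised : ∀ {x} → Killed K′ c′ x → S x ≡ true
  realised (j′ , b , cj′ , z , refl , z∈) = from (realises z) (punchIn j j′ , b , cj′ , z∈)

  S-identify : ∀ z → S (identify a y z) ≡ true → Killed K c z
  S-identify z = to (realises z)

  -- Then x = y, and a is switched off by another cell: cell j switches off at most one of a
  -- and punchIn a y.
  killed-via-a : ∀ {x b} → c j ≡ just b → punchIn a x ∈ K j b → S x ≡ true → Killed K′ c′ x
  killed-via-a {x} {b} cj X∈ Sx with cell-j b
  ... | inj₁ ⊆a = contradiction (sym (⊆a X∈)) (punchInᵢ≢i a x)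
  ... | inj₂ ⊆y with punchIn-injective a y x (⊆y X∈)
  ...   | refl with killed-split {K = K} {x = a} j
                     (S-identify a (trans (cong S (insertAt-lookup id a y)) Sx))
  ...     | inj₂ a-killed = subst (Killed K′ c′) (insertAt-lookup id a y) (lift a-killed)
  ...     | inj₁ (b′ , cj′ , a∈) with just-injective (trans (sym cj) cj′)
  ...       | refl = contradiction (⊆y a∈) (punchInᵢ≢i a y)

  killed : ∀ x → S x ≡ true → Killed K′ c′ x
  killed x Sx with killed-split {K = K} {x = punchIn a x} j
                     (S-identify (punchIn a x) (trans (cong S (insertAt-punchIn id a y x)) Sx))
  ... | inj₁ (b , cj , X∈) = killed-via-a {x} cj X∈ Sx
  ... | inj₂ X-killed      = subst (Killed K′ c′) (insertAt-punchIn id a y x) (lift X-killed)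

shatters⇒≤ : {K : KillSystem n m} → Shatters K → m ≤ n
shatters⇒≤ {m = zero} _ = z≤n
shatters⇒≤ {zero} {suc m} shatters with shatters⇒isolates shatters zero
... | () , _
shatters⇒≤ {suc n} {suc m} {K} shatters with suc m ≤? suc n
... | yes m≤n = m≤n
... | no  m≰n with pigeonhole (≰⇒> m≰n) (proj₁ ∘ shatters⇒isolates shatters)
... | x , y , x<y , same-cell =
  s≤s (shatters⇒≤ (contract-shatters j x (punchOut x≢y) cell-j shatters))
  where
  x≢y = <⇒≢ x<y
  j = proj₁ (shatters⇒isolates shatters x)

  isolates-x : Isolates K j (proj₁ (proj₂ (shatters⇒isolates shatters x))) x
  isolates-x = proj₂ (proj₂ (shatters⇒isolates shatters x))

  isolates-y : Isolates K j (proj₁ (proj₂ (shatters⇒isolates shatters y))) y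
  isolates-y = subst (λ k → Isolates K k (proj₁ (proj₂ (shatters⇒isolates shatters y))) y)
                     (sym same-cell) (proj₂ (proj₂ (shatters⇒isolates shatters y)))

  cell-j : ∀ b → K j b ⊆ ｛ x ｝ ⊎ K j b ⊆ ｛ punchIn x (punchOut x≢y) ｝
  cell-j rewrite punchIn-punchOut x≢y = isolating-pair⇒⊆ {K = K} isolates-x isolates-y x≢y

implementable⇒≤ : (g : ℱ (suc q)) (z : Fin (suc q)) → g z ≡ false →
  Implementable•* (suc q) n g → q ≤ n
implementable⇒≤ {q} {n} g z gz≡false (u , ϑ , correct) = shatters⇒≤ shattering
  where
  K : KillSystem n q
  K j b x = T (u (punchIn z x) j) (bit b) ≡ false

  shattering : Shatters K
  shattering S = c , realises
    where
    f : ℱ (suc q)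
    f = insertAt (not ∘ S) z true

    f≢g : ¬ f ≗ g
    f≢g f≗g =
      contradiction (trans (sym (insertAt-lookup (not ∘ S) z true)) (trans (f≗g z) gz≡false)) λ ()

    φ : Φ∖ (suc q) g
    φ = f , f≢g

    c : Setting n
    c j = toMaybe (ϑ φ j)

    cell : Fin q → Fin n → Bool
    cell x j = T (u (punchIn z x) j) (embed* (ϑ φ j))

    realises : ∀ x → S x ≡ true ⇔ Killed K c x
    realises x = begin
      S x ≡ true
        ≈⟨ mk⇔ (cong not) not-injective ⟩
      not (S x) ≡ false
        ≡⟨ cong (_≡ false) (sym (insertAt-punchIn (not ∘ S) z true x)) ⟩
      f (punchIn z x) ≡ false
        ≡⟨ cong (_≡ false) (correct φ (punchIn z x)) ⟩
      ⋀ n (cell x) ≡ false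
        ≈⟨ ⋀≡false⇔∃ n ⟩
      (∃[ j ] cell x j ≡ false)
        ≈⟨ mk⇔ (map₂ (to (cell-kills _))) (map₂ (from (cell-kills _))) ⟩
      Killed K c x
        ∎
      where
      open SetoidReasoning (⇔-setoid 0ℓ)
      cell-kills : ∀ j → cell x j ≡ false ⇔ (∃[ b ] c j ≡ just b × x ∈ K j b)
      cell-kills j = T≡false⇔ (u (punchIn z x) j) (ϑ φ j)

-- The entry of w in its own cell. When f z = 0 and f w ≠ g w, that cell takes the state 1 to
-- switch off z, which must keep w alive iff f w = 1, i.e. iff g w = 0; hence • when g w = 1.
mark : Bool → B•
mark true  = bullet
mark false = bit true

vote : (fz fw gw : Bool) → B*
vote false true  false = bit true
vote false false true  = bit true
vote _     true  _     = star
vote _     false _     = bit false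

T-mark-vote : ∀ fz fw gw → T (mark gw) (embed* (vote fz fw gw)) ≡ fw
T-mark-vote false false false = refl
T-mark-vote false false true  = refl
T-mark-vote false true  false = refl
T-mark-vote false true  true  = refl
T-mark-vote true  false false = refl
T-mark-vote true  false true  = refl
T-mark-vote true  true  false = refl
T-mark-vote true  true  true  = refl

T-pivot-vote : ∀ fw gw → T (bit false) (embed* (vote true fw gw)) ≡ true
T-pivot-vote false _ = refl
T-pivot-vote true  _ = refl

T-pivot-vote-≢ : ∀ fw gw → fw ≢ gw → T (bit false) (embed* (vote false fw gw)) ≡ false
T-pivot-vote-≢ false false fw≢gw = contradiction refl fw≢gw
T-pivot-vote-≢ false true  _     = refl
T-pivot-vote-≢ true  false _     = refl
T-pivot-vote-≢ true  true  fw≢gw = contradiction refl fw≢gw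

implementable-exact : (g : ℱ (suc q)) (z : Fin (suc q)) → g z ≡ false → Implementable•* (suc q) q g
implementable-exact {q} g z gz≡false = u , ϑ , correct
  where
  diagonal : Fin q → Fin q → B•
  diagonal i j with i ≟ j
  ... | yes _ = mark (g (punchIn z i))
  ... | no  _ = star

  u : Fin (suc q) → Fin q → B•
  u = insertAt diagonal z (λ _ → bit false)

  votes : ℱ (suc q) → Fin q → B*
  votes f i = vote (f z) (f (punchIn z i)) (g (punchIn z i))

  ϑ : Φ∖ (suc q) g → Fin q → B*
  ϑ (f , _) = votes f

  u-pivot : ∀ j → u z j ≡ bit false
  u-pivot = cong-app (insertAt-lookup diagonal z (λ _ → bit false))

  u-own : ∀ i → u (punchIn z i) i ≡ mark (g (punchIn z i))
  u-own i rewrite insertAt-punchIn diagonal z (λ _ → bit false) i with i ≟ i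
  ... | yes _   = refl
  ... | no  i≢i = contradiction refl i≢i

  u-other : ∀ {i j} → j ≢ i → u (punchIn z i) j ≡ star
  u-other {i} {j} j≢i rewrite insertAt-punchIn diagonal z (λ _ → bit false) i with i ≟ j
  ... | yes i≡j = contradiction (sym i≡j) j≢i
  ... | no  _   = refl

  column : ℱ (suc q) → Fin (suc q) → Fin q → Bool
  column f x j = T (u x j) (embed* (votes f j))

  at-punchIn : ∀ f i → f (punchIn z i) ≡ ⋀ q (column f (punchIn z i))
  at-punchIn f i = sym (begin
    ⋀ q (column f (punchIn z i))
      ≡⟨ ⋀-single q i (λ j j≢i → cong (λ w → T w (embed* (votes f j))) (u-other j≢i)) ⟩
    column f (punchIn z i) i
      ≡⟨ cong (λ w → T w (embed* (votes f i))) (u-own i) ⟩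
    T (mark (g (punchIn z i))) (embed* (votes f i))
      ≡⟨ T-mark-vote (f z) (f (punchIn z i)) (g (punchIn z i)) ⟩
    f (punchIn z i)
      ∎)
    where open ≡-Reasoning

  at-pivot : ∀ f → ¬ f ≗ g → f z ≡ ⋀ q (column f z)
  at-pivot f f≢g with f z in fz
  ... | true  = sym (⋀≡true q λ j →
    trans (cong (λ w → T w (embed* (vote true (f (punchIn z j)) (g (punchIn z j))))) (u-pivot j))
          (T-pivot-vote (f (punchIn z j)) (g (punchIn z j))))
  ... | false with ¬≗⇒∃≢ f≢g
  ...   | w , fw≢gw with pivot-or-punchIn z w
  ...     | inj₁ refl       = contradiction (trans fz (sym gz≡false)) fw≢gw
  ...     | inj₂ (i , refl) = sym (from (⋀≡false⇔∃ q) (i ,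
    trans (cong (λ w → T w (embed* (vote false (f (punchIn z i)) (g (punchIn z i))))) (u-pivot i))
          (T-pivot-vote-≢ (f (punchIn z i)) (g (punchIn z i)) fw≢gw)))

  correct : (φ : Φ∖ (suc q) g) (x : Fin (suc q)) → proj₁ φ x ≡ ⋀ q (λ j → T (u x j) (embed* (ϑ φ j)))
  correct (f , f≢g) x with pivot-or-punchIn z x
  ... | inj₁ refl       = at-pivot f f≢g
  ... | inj₂ (i , refl) = at-punchIn f i

implementable-suc : {g : ℱ q} → Implementable•* q n g → Implementable•* q (suc n) g
implementable-suc (u , ϑ , correct) = (λ x → star ∷ u x) , (λ φ → star ∷ ϑ φ) , correct

implementable-mono : {g : ℱ q} → m ≤ n → Implementable•* q m g → Implementable•* q n g
implementable-mono = mono ∘ ≤⇒≤′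
  where
  mono : ∀ {q m n} {g : ℱ q} → m ≤′ n → Implementable•* q m g → Implementable•* q n g
  mono ≤′-refl        = id
  mono (≤′-step m≤′n) = implementable-suc ∘ mono m≤′n

proposition18 : (q n : ℕ) → 2 ≤ q → 1 ≤ n → (g : ℱ q) → ¬ (g ≗ 𝟙 q) →
    Implementable•* q n g ⇔ (q ≤ n + 1)
proposition18 (suc q) n _ _ g g≢𝟙 rewrite +-comm n 1 =
  mk⇔ (s≤s ∘ implementable⇒≤ g z gz≡false)
      (λ q≤n → implementable-mono (≤-pred q≤n) (implementable-exact g z gz≡false))
  where
  z = proj₁ (¬≗⇒∃≢ g≢𝟙)

  gz≡false : g z ≡ false
  gz≡false = ¬-not (proj₂ (¬≗⇒∃≢ g≢𝟙))
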